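{- Let $S_n=\sum_{k=0}^n\binom{n}{k}^2\binom{2k}{k}(2k+1)$ for $n\geq 0$. Then the sequence $\left\{\dfrac{\sqrt[n+1]{S_{n+1}}}{\sqrt[n]{S_n}}\right\}_{n\geq 1}$ is strictly decreasing. -}

module Defs where

open import Data.Nat using (ℕ; suc; _+_; _*_)
open import Data.Nat.Combinatorics using (_C_)
open import Data.List using (map; upTo)
open import Data.Nat.ListAction using (sum)

S : ℕ → ℕ
S n = sum (map (λ k → (n C k) * (n C k) * ((2 * k) C k) * (2 * k + 1)) (upTo (suc n)))

-- S n = (4 n + 3) A n / 3 where A n = Σₖ C(n,k)² C(2k,k), because telescoping in k, together
-- with an induction on n, gives 3 Σₖ k C(n,k)² C(2k,k) = 2 n A n. A WZ certificate proves the
-- Apéry-like recurrence (n+2)² A(n+2) − (10n² + 30n + 23) A(n+1) + 9 (n+1)² A n = 0, so S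
-- satisfies a three-term recurrence, and induction along it gives
-- 9 − 27 / (5 n (n+3)) ≤ S(n+1) / S n ≤ 9 (the lower bound for n ≥ 3). Put N = n (n+3).
-- As S(n+2) ≤ 9 S(n+1), the claim follows from (9 S n / S(n+1))^N · (S n)² < 81^n: Bernoulli's
-- inequality and the lower ratio bound give (9 S n / S(n+1))^N ≤ 5/2, while S n ≤ 9^(n−4) S 4
-- gives (S n)² < (2/5) 81^n for n ≥ 4. The cases n = 1, 2, 3 are computed.

module Submission where

import Algebra.Properties.CommutativeSemigroup as CommSemigroupProperties
open import Data.List.Base using ([_]; _++_; map; upTo)
open import Data.List.Properties using (map-++; map-cong; upTo-∷ʳ)
open import Data.Nat.Base using (ℕ; zero; suc; _+_; _*_; _∸_; _^_; _≤_; _<_; s≤s; z≤n; NonZero; >-nonZero)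
open import Data.Nat.Combinatorics using (_C_; nCk+nC[k+1]≡[n+1]C[k+1]; k>n⇒nCk≡0; nC1≡n)
open import Data.Nat.ListAction using (sum)
open import Data.Nat.ListAction.Properties using (sum-++)
open import Data.Nat.Properties
open import Data.Nat.Tactic.RingSolver using (solve-∀)
open import Data.Sum.Base using (inj₁; inj₂)
open import Data.Unit.Base using (tt)
open import Function.Base using (_∘_)
open import Relation.Binary.PropositionalEquality using (_≡_; refl; sym; trans; cong; cong₂; subst₂)
open import Relation.Nullary.Decidable.Core using (yes; no)
open import Defs

open ≤-Reasoning
open CommSemigroupProperties *-commutativeSemigroup using (x∙yz≈y∙xz; x∙yz≈yx∙z; xy∙z≈y∙xz)
open CommSemigroupProperties +-commutativeSemigroup
  using (interchange) renaming (x∙yz≈xz∙y to x+[y+z]≡x+z+y; xy∙z≈xz∙y to x+y+z≡x+z+y)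

c+[k+m]∸k≡c+m : ∀ c k m → c + (k + m) ∸ k ≡ c + m
c+[k+m]∸k≡c+m c k m = trans (+-∸-assoc c (m≤m+n k m)) (cong (c +_) (m+n∸m≡n k m))

[k+1]*[n+1]C[k+1]≡[n+1]*nCk : ∀ n k → suc k * (suc n C suc k) ≡ suc n * (n C k)
[k+1]*[n+1]C[k+1]≡[n+1]*nCk zero    zero    = refl
[k+1]*[n+1]C[k+1]≡[n+1]*nCk zero    (suc k) = *-zeroʳ (2 + k)
[k+1]*[n+1]C[k+1]≡[n+1]*nCk (suc n) zero    =
  trans (+-identityʳ _) (trans (nC1≡n (2 + n)) (sym (*-identityʳ (2 + n))))
[k+1]*[n+1]C[k+1]≡[n+1]*nCk (suc n) (suc k) = begin-equality
  (2 + k) * ((2 + n) C (2 + k))            ≡⟨ cong ((2 + k) *_) (pascal (suc n) (suc k)) ⟨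
  (2 + k) * (c + c′)                       ≡⟨ regroup k c c′ ⟩
  (1 + k) * c + (2 + k) * c′ + c           ≡⟨ cong₂ (λ u v → u + v + c) ([k+1]*[n+1]C[k+1]≡[n+1]*nCk n k)
                                                                     ([k+1]*[n+1]C[k+1]≡[n+1]*nCk n (suc k)) ⟩
  (1 + n) * (n C k) + (1 + n) * (n C suc k) + c ≡⟨ cong (_+ c) (*-distribˡ-+ (1 + n) (n C k) (n C suc k)) ⟨
  (1 + n) * (n C k + n C suc k) + c        ≡⟨ cong (λ u → (1 + n) * u + c) (pascal n k) ⟩
  (1 + n) * c + c                          ≡⟨ +-comm ((1 + n) * c) c ⟩
  (2 + n) * c                              ∎
  where
  pascal = nCk+nC[k+1]≡[n+1]C[k+1]
  c  = suc n C suc k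
  c′ = suc n C suc (suc k)
  regroup : ∀ k c c′ → (2 + k) * (c + c′) ≡ (1 + k) * c + (2 + k) * c′ + c
  regroup = solve-∀

[n+1]*[n+1]Ck≡[n+1]*nCk+k*[n+1]Ck : ∀ n k → suc n * (suc n C k) ≡ suc n * (n C k) + k * (suc n C k)
[n+1]*[n+1]Ck≡[n+1]*nCk+k*[n+1]Ck n zero    = sym (+-identityʳ _)
[n+1]*[n+1]Ck≡[n+1]*nCk+k*[n+1]Ck n (suc k) = begin-equality
  suc n * (suc n C suc k)                        ≡⟨ cong (suc n *_) (nCk+nC[k+1]≡[n+1]C[k+1] n k) ⟨
  suc n * (n C k + n C suc k)                    ≡⟨ *-distribˡ-+ (suc n) (n C k) (n C suc k) ⟩
  suc n * (n C k) + suc n * (n C suc k)          ≡⟨ cong (_+ suc n * (n C suc k)) ([k+1]*[n+1]C[k+1]≡[n+1]*nCk n k) ⟨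
  suc k * (suc n C suc k) + suc n * (n C suc k)  ≡⟨ +-comm (suc k * (suc n C suc k)) (suc n * (n C suc k)) ⟩
  suc n * (n C suc k) + suc k * (suc n C suc k)  ∎

[n+1]*nCk≡[n+1∸k]*[n+1]Ck : ∀ n k → suc n * (n C k) ≡ (suc n ∸ k) * (suc n C k)
[n+1]*nCk≡[n+1∸k]*[n+1]Ck n k with k ≤? suc n
... | yes k≤n+1 = +-cancelʳ-≡ (k * (suc n C k)) _ _ (begin-equality
  suc n * (n C k) + k * (suc n C k)            ≡⟨ [n+1]*[n+1]Ck≡[n+1]*nCk+k*[n+1]Ck n k ⟨
  suc n * (suc n C k)                          ≡⟨ cong (_* (suc n C k)) (m∸n+n≡m k≤n+1) ⟨
  (suc n ∸ k + k) * (suc n C k)                ≡⟨ *-distribʳ-+ (suc n C k) (suc n ∸ k) k ⟩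
  (suc n ∸ k) * (suc n C k) + k * (suc n C k)  ∎)
... | no k≰n+1 = begin-equality
  suc n * (n C k)            ≡⟨ cong (suc n *_) (k>n⇒nCk≡0 (<-trans (n<1+n n) n+1<k)) ⟩
  suc n * 0                  ≡⟨ *-zeroʳ (suc n) ⟩
  0                          ≡⟨ *-zeroʳ (suc n ∸ k) ⟨
  (suc n ∸ k) * 0            ≡⟨ cong ((suc n ∸ k) *_) (k>n⇒nCk≡0 n+1<k) ⟨
  (suc n ∸ k) * (suc n C k)  ∎
  where n+1<k = ≰⇒> k≰n+1

[k+1]*nC[k+1]≡[n∸k]*nCk : ∀ n k → suc k * (n C suc k) ≡ (n ∸ k) * (n C k)
[k+1]*nC[k+1]≡[n∸k]*nCk zero    k = trans (*-zeroʳ (suc k)) (cong (_* (0 C k)) (sym (0∸n≡0 k)))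
[k+1]*nC[k+1]≡[n∸k]*nCk (suc n) k = trans ([k+1]*[n+1]C[k+1]≡[n+1]*nCk n k) ([n+1]*nCk≡[n+1∸k]*[n+1]Ck n k)

[k+1]*[2k+2]C[k+1]≡2[2k+1]*[2k]Ck : ∀ k → suc k * ((2 * suc k) C suc k) ≡ 2 * (2 * k + 1) * ((2 * k) C k)
[k+1]*[2k+2]C[k+1]≡2[2k+1]*[2k]Ck k = *-cancelˡ-≡ _ _ (suc k) (begin-equality
  suc k * (suc k * ((2 * suc k) C suc k))   ≡⟨ cong (λ m → suc k * (suc k * (m C suc k))) (*-suc 2 k) ⟩
  suc k * (suc k * ((2 + 2 * k) C suc k))   ≡⟨ cong (suc k *_) ([k+1]*[n+1]C[k+1]≡[n+1]*nCk (1 + 2 * k) k) ⟩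
  suc k * ((2 + 2 * k) * c)                 ≡⟨ x∙yz≈y∙xz (suc k) (2 + 2 * k) c ⟩
  (2 + 2 * k) * (suc k * c)                 ≡⟨ cong (λ m → (2 + 2 * k) * (m * c)) 2k+1∸k≡k+1 ⟨
  (2 + 2 * k) * ((1 + 2 * k ∸ k) * c)       ≡⟨ cong ((2 + 2 * k) *_) ([n+1]*nCk≡[n+1∸k]*[n+1]Ck (2 * k) k) ⟨
  (2 + 2 * k) * ((1 + 2 * k) * ((2 * k) C k)) ≡⟨ double-odd k ((2 * k) C k) ⟩
  suc k * (2 * (2 * k + 1) * ((2 * k) C k)) ∎)
  where
  c = (1 + 2 * k) C k
  double-odd : ∀ k c → (2 + 2 * k) * ((1 + 2 * k) * c) ≡ (1 + k) * (2 * (2 * k + 1) * c)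
  double-odd = solve-∀
  2k+1∸k≡k+1 : 1 + 2 * k ∸ k ≡ suc k
  2k+1∸k≡k+1 = trans (c+[k+m]∸k≡c+m 1 k (k + 0)) (cong suc (+-identityʳ k))

F : ℕ → ℕ → ℕ
F n k = (n C k) * (n C k) * ((2 * k) C k)

F-vanishes : ∀ {n k} → n < k → F n k ≡ 0
F-vanishes n<k = cong (λ c → c * c * _) (k>n⇒nCk≡0 n<k)

F-shift-n : ∀ n k → suc n * suc n * F n k ≡ (suc n ∸ k) * (suc n ∸ k) * F (suc n) k
F-shift-n n k = begin-equality
  suc n * suc n * (c * c * e)                          ≡⟨ square-out (suc n) c e ⟩
  suc n * c * (suc n * c) * e                          ≡⟨ cong (λ u → u * u * e) ([n+1]*nCk≡[n+1∸k]*[n+1]Ck n k) ⟩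
  (suc n ∸ k) * c′ * ((suc n ∸ k) * c′) * e            ≡⟨ square-out (suc n ∸ k) c′ e ⟨
  (suc n ∸ k) * (suc n ∸ k) * (c′ * c′ * e)            ∎
  where
  c  = n C k
  c′ = suc n C k
  e  = (2 * k) C k
  square-out : ∀ a c e → a * a * (c * c * e) ≡ a * c * (a * c) * e
  square-out = solve-∀

F-shift-k : ∀ n k → suc k * suc k * suc k * F n (suc k) ≡ 2 * (2 * k + 1) * ((n ∸ k) * (n ∸ k) * F n k)
F-shift-k n k = begin-equality
  suc k * suc k * suc k * (c′ * c′ * e′)        ≡⟨ cube-out (suc k) c′ e′ ⟩
  suc k * c′ * (suc k * c′) * (suc k * e′)      ≡⟨ cong₂ (λ u v → u * u * v) ([k+1]*nC[k+1]≡[n∸k]*nCk n k)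
                                                                          ([k+1]*[2k+2]C[k+1]≡2[2k+1]*[2k]Ck k) ⟩
  (n ∸ k) * c * ((n ∸ k) * c) * (2 * (2 * k + 1) * e) ≡⟨ collect (n ∸ k) c e (2 * (2 * k + 1)) ⟩
  2 * (2 * k + 1) * ((n ∸ k) * (n ∸ k) * (c * c * e)) ∎
  where
  c  = n C k
  c′ = n C suc k
  e  = (2 * k) C k
  e′ = (2 * suc k) C suc k
  cube-out : ∀ a c e → a * a * a * (c * c * e) ≡ a * c * (a * c) * (a * e)
  cube-out = solve-∀
  collect : ∀ d c e m → d * c * (d * c) * (m * e) ≡ m * (d * d * (c * c * e))
  collect = solve-∀

F-support-cong : ∀ {p q} n k → (k ≤ n → p ≡ q) → p * F n k ≡ q * F n k
F-support-cong n k p≡q with k ≤? n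
... | yes k≤n = cong (_* F n k) (p≡q k≤n)
F-support-cong {p} {q} n k _ | no k≰n rewrite F-vanishes (≰⇒> k≰n) | *-zeroʳ p | *-zeroʳ q = refl

∑ : ℕ → (ℕ → ℕ) → ℕ
∑ M f = sum (map f (upTo M))

syntax ∑ M (λ k → e) = ∑[ k < M ] e

∑-suc : ∀ M f → ∑ (suc M) f ≡ ∑ M f + f M
∑-suc M f = begin-equality
  sum (map f (upTo (suc M)))       ≡⟨ cong (sum ∘ map f) (upTo-∷ʳ M) ⟨
  sum (map f (upTo M ++ [ M ]))    ≡⟨ cong sum (map-++ f (upTo M) [ M ]) ⟩
  sum (map f (upTo M) ++ [ f M ])  ≡⟨ sum-++ (map f (upTo M)) [ f M ] ⟩
  ∑ M f + (f M + 0)                ≡⟨ cong (∑ M f +_) (+-identityʳ (f M)) ⟩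
  ∑ M f + f M                      ∎

∑-cong : ∀ M {f g} → (∀ k → f k ≡ g k) → ∑ M f ≡ ∑ M g
∑-cong M f≗g = cong sum (map-cong f≗g (upTo M))

∑-* : ∀ M a f → ∑[ k < M ] (a * f k) ≡ a * ∑ M f
∑-* zero    a f = sym (*-zeroʳ a)
∑-* (suc M) a f = begin-equality
  ∑[ k < suc M ] (a * f k)      ≡⟨ ∑-suc M (λ k → a * f k) ⟩
  ∑[ k < M ] (a * f k) + a * f M  ≡⟨ cong (_+ a * f M) (∑-* M a f) ⟩
  a * ∑ M f + a * f M           ≡⟨ *-distribˡ-+ a (∑ M f) (f M) ⟨
  a * (∑ M f + f M)             ≡⟨ cong (a *_) (∑-suc M f) ⟨
  a * ∑ (suc M) f               ∎

∑-+ : ∀ M f g → ∑[ k < M ] (f k + g k) ≡ ∑ M f + ∑ M g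
∑-+ zero    f g = refl
∑-+ (suc M) f g = begin-equality
  ∑[ k < suc M ] (f k + g k)             ≡⟨ ∑-suc M (λ k → f k + g k) ⟩
  ∑[ k < M ] (f k + g k) + (f M + g M)   ≡⟨ cong (_+ (f M + g M)) (∑-+ M f g) ⟩
  ∑ M f + ∑ M g + (f M + g M)            ≡⟨ interchange (∑ M f) (∑ M g) (f M) (g M) ⟩
  (∑ M f + f M) + (∑ M g + g M)          ≡⟨ cong₂ _+_ (∑-suc M f) (∑-suc M g) ⟨
  ∑ (suc M) f + ∑ (suc M) g              ∎

∑-linear : ∀ M a b f g → ∑[ k < M ] (a * f k + b * g k) ≡ a * ∑ M f + b * ∑ M g
∑-linear M a b f g =
  trans (∑-+ M (λ k → a * f k) (λ k → b * g k)) (cong₂ _+_ (∑-* M a f) (∑-* M b g))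

∑-vanishing-tail : ∀ N {f} → (∀ {k} → N ≤ k → f k ≡ 0) → ∀ j → ∑ (j + N) f ≡ ∑ N f
∑-vanishing-tail N         f≡0 zero    = refl
∑-vanishing-tail N {f} f≡0 (suc j) = begin-equality
  ∑ (suc j + N) f            ≡⟨ ∑-suc (j + N) f ⟩
  ∑ (j + N) f + f (j + N)    ≡⟨ cong (∑ (j + N) f +_) (f≡0 (m≤n+m N j)) ⟩
  ∑ (j + N) f + 0            ≡⟨ +-identityʳ _ ⟩
  ∑ (j + N) f                ≡⟨ ∑-vanishing-tail N f≡0 j ⟩
  ∑ N f                      ∎

∑-telescope : ∀ M (L R G : ℕ → ℕ) → (∀ k → L k + G (suc k) ≡ R k + G k) → ∑ M L + G M ≡ ∑ M R + G 0
∑-telescope zero    L R G step = refl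
∑-telescope (suc M) L R G step = begin-equality
  ∑ (suc M) L + G (suc M)     ≡⟨ cong (_+ G (suc M)) (∑-suc M L) ⟩
  ∑ M L + L M + G (suc M)     ≡⟨ +-assoc (∑ M L) (L M) (G (suc M)) ⟩
  ∑ M L + (L M + G (suc M))   ≡⟨ cong (∑ M L +_) (step M) ⟩
  ∑ M L + (R M + G M)         ≡⟨ x+[y+z]≡x+z+y (∑ M L) (R M) (G M) ⟩
  ∑ M L + G M + R M           ≡⟨ cong (_+ R M) (∑-telescope M L R G step) ⟩
  ∑ M R + G 0 + R M           ≡⟨ x+y+z≡x+z+y (∑ M R) (G 0) (R M) ⟩
  ∑ M R + R M + G 0           ≡⟨ cong (_+ G 0) (∑-suc M R) ⟨
  ∑ (suc M) R + G 0           ∎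

∑-telescope-vanishing : ∀ M (L R G : ℕ → ℕ) → G 0 ≡ 0 → G M ≡ 0 →
                        (∀ k → L k + G (suc k) ≡ R k + G k) → ∑ M L ≡ ∑ M R
∑-telescope-vanishing M L R G G0≡0 GM≡0 step = begin-equality
  ∑ M L          ≡⟨ +-identityʳ (∑ M L) ⟨
  ∑ M L + 0      ≡⟨ cong (∑ M L +_) GM≡0 ⟨
  ∑ M L + G M    ≡⟨ ∑-telescope M L R G step ⟩
  ∑ M R + G 0    ≡⟨ cong (∑ M R +_) G0≡0 ⟩
  ∑ M R + 0      ≡⟨ +-identityʳ (∑ M R) ⟩
  ∑ M R          ∎

A B : ℕ → ℕ
A n = ∑[ k < suc n ] F n k
B n = ∑[ k < suc n ] (k * F n k)

A-padded : ∀ n j → ∑ (j + suc n) (F n) ≡ A n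
A-padded n = ∑-vanishing-tail (suc n) {F n} F-vanishes

B-padded : ∀ n j → ∑[ k < j + suc n ] (k * F n k) ≡ B n
B-padded n = ∑-vanishing-tail (suc n) {λ k → k * F n k} (λ {k} n<k → trans (cong (k *_) (F-vanishes n<k)) (*-zeroʳ k))

F-shift-n² : ∀ n k → (2 + n) * (2 + n) * ((1 + n) * (1 + n) * F n k)
                     ≡ (1 + n ∸ k) * (1 + n ∸ k) * ((2 + n ∸ k) * (2 + n ∸ k) * F (2 + n) k)
F-shift-n² n k = begin-equality
  q * (p * F n k)              ≡⟨ cong (q *_) (F-shift-n n k) ⟩
  q * (d₁² * F (1 + n) k)      ≡⟨ x∙yz≈y∙xz q d₁² (F (1 + n) k) ⟩
  d₁² * (q * F (1 + n) k)      ≡⟨ cong (d₁² *_) (F-shift-n (1 + n) k) ⟩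
  d₁² * (d₂² * F (2 + n) k)    ∎
  where
  p   = (1 + n) * (1 + n)
  q   = (2 + n) * (2 + n)
  d₁² = (1 + n ∸ k) * (1 + n ∸ k)
  d₂² = (2 + n ∸ k) * (2 + n ∸ k)

-- The WZ certificate k³ (4 (n + 2) − 3 k) F (n + 2) k, with 4 (n + 2) − 3 k written as
-- 3 (n + 2 − k) + (n + 2): the truncated subtraction only matters where F (n + 2) k = 0.
G-A : ℕ → ℕ → ℕ
G-A n k = F (2 + n) k * (k * k * k * (3 * (2 + n ∸ k) + (2 + n)))

A-coefficients-k≤n : ∀ k m →
  (2 + (k + m)) * (2 + (k + m)) * ((2 + (k + m)) * (2 + (k + m))) + 9 * ((1 + m) * (1 + m) * ((2 + m) * (2 + m)))
    + (3 * (1 + m) + (2 + (k + m))) * (2 * (2 * k + 1) * ((2 + m) * (2 + m)))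
  ≡ (10 * ((k + m) * (k + m)) + 30 * (k + m) + 23) * ((2 + m) * (2 + m)) + k * k * k * (3 * (2 + m) + (2 + (k + m)))
A-coefficients-k≤n = solve-∀

A-coefficients-k≡n+1 : ∀ n →
  (2 + n) * (2 + n) * ((2 + n) * (2 + n)) + 9 * (0 * 0 * (1 * 1)) + (3 * 0 + (2 + n)) * (2 * (2 * (1 + n) + 1) * (1 * 1))
  ≡ (10 * (n * n) + 30 * n + 23) * (1 * 1) + (1 + n) * (1 + n) * (1 + n) * (3 * 1 + (2 + n))
A-coefficients-k≡n+1 = solve-∀

A-coefficients-k≡n+2 : ∀ n →
  (2 + n) * (2 + n) * ((2 + n) * (2 + n)) + 9 * (0 * 0 * (0 * 0)) + (3 * 0 + (2 + n)) * (2 * (2 * (2 + n) + 1) * (0 * 0))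
  ≡ (10 * (n * n) + 30 * n + 23) * (0 * 0) + (2 + n) * (2 + n) * (2 + n) * (3 * 0 + (2 + n))
A-coefficients-k≡n+2 = solve-∀

A-coefficients : ∀ n k → k ≤ 2 + n →
  let d₁ = 1 + n ∸ k; d₂ = 2 + n ∸ k in
  (2 + n) * (2 + n) * ((2 + n) * (2 + n)) + 9 * (d₁ * d₁ * (d₂ * d₂))
    + (3 * d₁ + (2 + n)) * (2 * (2 * k + 1) * (d₂ * d₂))
  ≡ (10 * (n * n) + 30 * n + 23) * (d₂ * d₂) + k * k * k * (3 * d₂ + (2 + n))
A-coefficients n k k≤n+2 with m≤n⇒m<n∨m≡n k≤n+2
... | inj₂ refl rewrite n∸n≡0 n | m≤n⇒m∸n≡0 (n≤1+n n) = A-coefficients-k≡n+2 n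
... | inj₁ (s≤s k≤n+1) with m≤n⇒m<n∨m≡n k≤n+1
...   | inj₂ refl rewrite n∸n≡0 n | m+n∸n≡m 1 n = A-coefficients-k≡n+1 n
...   | inj₁ (s≤s k≤n) with n ∸ k | m+[n∸m]≡n k≤n
...     | m | refl rewrite c+[k+m]∸k≡c+m 1 k m | c+[k+m]∸k≡c+m 2 k m = A-coefficients-k≤n k m

A-step : ∀ n k →
  (2 + n) * (2 + n) * ((2 + n) * (2 + n)) * F (2 + n) k + 9 * ((1 + n) * (1 + n) * ((2 + n) * (2 + n))) * F n k + G-A n (suc k)
  ≡ (2 + n) * (2 + n) * (10 * (n * n) + 30 * n + 23) * F (1 + n) k + G-A n k
A-step n k = begin-equality
  c₂ * F₂ + 9 * (p * q) * F n k + F₃ * (suc k * suc k * suc k * v₁)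
    ≡⟨ regroup c₂ F₂ p q (F n k) F₃ (suc k * suc k * suc k) v₁ ⟩
  c₂ * F₂ + 9 * (q * (p * F n k)) + v₁ * (suc k * suc k * suc k * F₃)
    ≡⟨ cong₂ (λ u w → c₂ * F₂ + 9 * u + v₁ * w) (F-shift-n² n k) (F-shift-k (2 + n) k) ⟩
  c₂ * F₂ + 9 * (d₁ * d₁ * (d₂ * d₂ * F₂)) + v₁ * (2 * (2 * k + 1) * (d₂ * d₂ * F₂))
    ≡⟨ collectₗ c₂ F₂ d₁ d₂ v₁ k ⟩
  (c₂ + 9 * (d₁ * d₁ * (d₂ * d₂)) + v₁ * (2 * (2 * k + 1) * (d₂ * d₂))) * F₂
    ≡⟨ F-support-cong (2 + n) k (A-coefficients n k) ⟩
  (a * (d₂ * d₂) + k * k * k * v₂) * F₂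
    ≡⟨ collectᵣ a d₂ F₂ (k * k * k) v₂ ⟩
  a * (d₂ * d₂ * F₂) + G-A n k
    ≡⟨ cong (λ u → a * u + G-A n k) (F-shift-n (1 + n) k) ⟨
  a * (q * F (1 + n) k) + G-A n k
    ≡⟨ cong (_+ G-A n k) (x∙yz≈yx∙z a q (F (1 + n) k)) ⟩
  q * a * F (1 + n) k + G-A n k ∎
  where
  p  = (1 + n) * (1 + n)
  q  = (2 + n) * (2 + n)
  c₂ = q * q
  a  = 10 * (n * n) + 30 * n + 23
  d₁ = 1 + n ∸ k
  d₂ = 2 + n ∸ k
  v₁ = 3 * d₁ + (2 + n)
  v₂ = 3 * d₂ + (2 + n)
  F₂ = F (2 + n) k
  F₃ = F (2 + n) (suc k)
  regroup : ∀ c f p q f₀ f₃ e v → c * f + 9 * (p * q) * f₀ + f₃ * (e * v) ≡ c * f + 9 * (q * (p * f₀)) + v * (e * f₃)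
  regroup = solve-∀
  collectₗ : ∀ c f d₁ d₂ v k →
    c * f + 9 * (d₁ * d₁ * (d₂ * d₂ * f)) + v * (2 * (2 * k + 1) * (d₂ * d₂ * f))
    ≡ (c + 9 * (d₁ * d₁ * (d₂ * d₂)) + v * (2 * (2 * k + 1) * (d₂ * d₂))) * f
  collectₗ = solve-∀
  collectᵣ : ∀ a d f e v → (a * (d * d) + e * v) * f ≡ a * (d * d * f) + f * (e * v)
  collectᵣ = solve-∀

A-recurrence : ∀ n → (2 + n) * (2 + n) * A (2 + n) + 9 * ((1 + n) * (1 + n)) * A n ≡ (10 * (n * n) + 30 * n + 23) * A (1 + n)
A-recurrence n = *-cancelˡ-≡ _ _ q (begin-equality
  q * (q * A (2 + n) + 9 * p * A n)                 ≡⟨ spread q p (A (2 + n)) (A n) ⟩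
  q * q * A (2 + n) + 9 * (p * q) * A n             ≡⟨ cong (λ u → q * q * A (2 + n) + 9 * (p * q) * u) (A-padded n 2) ⟨
  q * q * ∑ (3 + n) (F (2 + n)) + 9 * (p * q) * ∑ (3 + n) (F n)
                                                    ≡⟨ ∑-linear (3 + n) (q * q) (9 * (p * q)) (F (2 + n)) (F n) ⟨
  ∑[ k < 3 + n ] (q * q * F (2 + n) k + 9 * (p * q) * F n k)
                                                    ≡⟨ ∑-telescope-vanishing (3 + n) _ _ (G-A n) refl G-A-top (A-step n) ⟩
  ∑[ k < 3 + n ] (q * a * F (1 + n) k)              ≡⟨ ∑-* (3 + n) (q * a) (F (1 + n)) ⟩
  q * a * ∑ (3 + n) (F (1 + n))                     ≡⟨ cong (q * a *_) (A-padded (1 + n) 1) ⟩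
  q * a * A (1 + n)                                 ≡⟨ *-assoc q a (A (1 + n)) ⟩
  q * (a * A (1 + n))                               ∎)
  where
  p = (1 + n) * (1 + n)
  q = (2 + n) * (2 + n)
  a = 10 * (n * n) + 30 * n + 23
  G-A-top : G-A n (3 + n) ≡ 0
  G-A-top = cong (_* ((3 + n) * (3 + n) * (3 + n) * (3 * (2 + n ∸ (3 + n)) + (2 + n)))) (F-vanishes (n<1+n (2 + n)))
  spread : ∀ q p x y → q * (q * x + 9 * p * y) ≡ q * q * x + 9 * (p * q) * y
  spread = solve-∀

G-B : ℕ → ℕ → ℕ
G-B n k = F (1 + n) k * (k * k * k)

B-coefficients-k≤n : ∀ k m →
  3 * k * ((1 + (k + m)) * (1 + (k + m))) + 2 * (k + m) * ((1 + m) * (1 + m)) + 2 * (2 * k + 1) * ((1 + m) * (1 + m))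
  ≡ (2 + 2 * (k + m)) * ((1 + (k + m)) * (1 + (k + m))) + 3 * k * ((1 + m) * (1 + m)) + k * k * k
B-coefficients-k≤n = solve-∀

B-coefficients-k≡n+1 : ∀ n →
  3 * (1 + n) * ((1 + n) * (1 + n)) + 2 * n * (0 * 0) + 2 * (2 * (1 + n) + 1) * (0 * 0)
  ≡ (2 + 2 * n) * ((1 + n) * (1 + n)) + 3 * (1 + n) * (0 * 0) + (1 + n) * (1 + n) * (1 + n)
B-coefficients-k≡n+1 = solve-∀

B-coefficients : ∀ n k → k ≤ 1 + n →
  let d = 1 + n ∸ k in
  3 * k * ((1 + n) * (1 + n)) + 2 * n * (d * d) + 2 * (2 * k + 1) * (d * d)
  ≡ (2 + 2 * n) * ((1 + n) * (1 + n)) + 3 * k * (d * d) + k * k * k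
B-coefficients n k k≤n+1 with m≤n⇒m<n∨m≡n k≤n+1
... | inj₂ refl rewrite n∸n≡0 n = B-coefficients-k≡n+1 n
... | inj₁ (s≤s k≤n) with n ∸ k | m+[n∸m]≡n k≤n
...   | m | refl rewrite c+[k+m]∸k≡c+m 1 k m = B-coefficients-k≤n k m

B-step : ∀ n k →
  3 * ((1 + n) * (1 + n)) * (k * F (1 + n) k) + 2 * n * ((1 + n) * (1 + n)) * F n k + G-B n (suc k)
  ≡ (2 + 2 * n) * ((1 + n) * (1 + n)) * F (1 + n) k + 3 * ((1 + n) * (1 + n)) * (k * F n k) + G-B n k
B-step n k = begin-equality
  3 * p * (k * F₁) + 2 * n * p * F n k + F₃ * (suc k * suc k * suc k)
    ≡⟨ regroupₗ p k F₁ (2 * n) (F n k) F₃ (suc k * suc k * suc k) ⟩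
  3 * k * p * F₁ + 2 * n * (p * F n k) + suc k * suc k * suc k * F₃
    ≡⟨ cong₂ (λ u w → 3 * k * p * F₁ + 2 * n * u + w) (F-shift-n n k) (F-shift-k (1 + n) k) ⟩
  3 * k * p * F₁ + 2 * n * (d * d * F₁) + 2 * (2 * k + 1) * (d * d * F₁)
    ≡⟨ collectₗ (3 * k * p) (2 * n) (2 * (2 * k + 1)) d F₁ ⟩
  (3 * k * p + 2 * n * (d * d) + 2 * (2 * k + 1) * (d * d)) * F₁
    ≡⟨ F-support-cong (1 + n) k (B-coefficients n k) ⟩
  ((2 + 2 * n) * p + 3 * k * (d * d) + k * k * k) * F₁
    ≡⟨ collectᵣ ((2 + 2 * n) * p) (3 * k) d F₁ (k * k * k) ⟩
  (2 + 2 * n) * p * F₁ + 3 * k * (d * d * F₁) + G-B n k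
    ≡⟨ cong (λ u → (2 + 2 * n) * p * F₁ + 3 * k * u + G-B n k) (F-shift-n n k) ⟨
  (2 + 2 * n) * p * F₁ + 3 * k * (p * F n k) + G-B n k
    ≡⟨ cong (λ u → (2 + 2 * n) * p * F₁ + u + G-B n k) (regroupᵣ k p (F n k)) ⟩
  (2 + 2 * n) * p * F₁ + 3 * p * (k * F n k) + G-B n k ∎
  where
  p  = (1 + n) * (1 + n)
  d  = 1 + n ∸ k
  F₁ = F (1 + n) k
  F₃ = F (1 + n) (suc k)
  regroupₗ : ∀ p k f₁ a f₀ f₃ e → 3 * p * (k * f₁) + a * p * f₀ + f₃ * e ≡ 3 * k * p * f₁ + a * (p * f₀) + e * f₃
  regroupₗ = solve-∀
  collectₗ : ∀ a b c d f → a * f + b * (d * d * f) + c * (d * d * f) ≡ (a + b * (d * d) + c * (d * d)) * f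
  collectₗ = solve-∀
  collectᵣ : ∀ a b d f e → (a + b * (d * d) + e) * f ≡ a * f + b * (d * d * f) + f * e
  collectᵣ = solve-∀
  regroupᵣ : ∀ k p f → 3 * k * (p * f) ≡ 3 * p * (k * f)
  regroupᵣ = solve-∀

B-recurrence : ∀ n → 3 * B (1 + n) + 2 * n * A n ≡ (2 + 2 * n) * A (1 + n) + 3 * B n
B-recurrence n = *-cancelˡ-≡ _ _ p (begin-equality
  p * (3 * B (1 + n) + 2 * n * A n)                    ≡⟨ spread n p (B (1 + n)) (A n) ⟩
  3 * p * B (1 + n) + 2 * n * p * A n                  ≡⟨ cong (λ u → 3 * p * B (1 + n) + 2 * n * p * u) (A-padded n 1) ⟨
  3 * p * B (1 + n) + 2 * n * p * ∑ (2 + n) (F n)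
    ≡⟨ ∑-linear (2 + n) (3 * p) (2 * n * p) (λ k → k * F (1 + n) k) (F n) ⟨
  ∑[ k < 2 + n ] (3 * p * (k * F (1 + n) k) + 2 * n * p * F n k)
    ≡⟨ ∑-telescope-vanishing (2 + n) _ _ (G-B n) refl G-B-top (B-step n) ⟩
  ∑[ k < 2 + n ] ((2 + 2 * n) * p * F (1 + n) k + 3 * p * (k * F n k))
    ≡⟨ ∑-linear (2 + n) ((2 + 2 * n) * p) (3 * p) (F (1 + n)) (λ k → k * F n k) ⟩
  (2 + 2 * n) * p * A (1 + n) + 3 * p * ∑[ k < 2 + n ] (k * F n k)
    ≡⟨ cong (λ u → (2 + 2 * n) * p * A (1 + n) + 3 * p * u) (B-padded n 1) ⟩
  (2 + 2 * n) * p * A (1 + n) + 3 * p * B n           ≡⟨ spread′ n p (A (1 + n)) (B n) ⟨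
  p * ((2 + 2 * n) * A (1 + n) + 3 * B n)             ∎)
  where
  p = (1 + n) * (1 + n)
  G-B-top : G-B n (2 + n) ≡ 0
  G-B-top = cong (_* ((2 + n) * (2 + n) * (2 + n))) (F-vanishes (n<1+n (1 + n)))
  spread : ∀ n p x y → p * (3 * x + 2 * n * y) ≡ 3 * p * x + 2 * n * p * y
  spread = solve-∀
  spread′ : ∀ n p x y → p * ((2 + 2 * n) * x + 3 * y) ≡ (2 + 2 * n) * p * x + 3 * p * y
  spread′ = solve-∀

3*Bn≡2n*An : ∀ n → 3 * B n ≡ 2 * n * A n
3*Bn≡2n*An zero    = refl
3*Bn≡2n*An (suc n) = +-cancelʳ-≡ (2 * n * A n) _ _ (begin-equality
  3 * B (1 + n) + 2 * n * A n              ≡⟨ B-recurrence n ⟩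
  (2 + 2 * n) * A (1 + n) + 3 * B n        ≡⟨ cong ((2 + 2 * n) * A (1 + n) +_) (3*Bn≡2n*An n) ⟩
  (2 + 2 * n) * A (1 + n) + 2 * n * A n    ≡⟨ cong (λ u → u * A (1 + n) + 2 * n * A n) (*-suc 2 n) ⟨
  2 * suc n * A (suc n) + 2 * n * A n      ∎)

3*Sn≡[4n+3]*An : ∀ n → 3 * S n ≡ (4 * n + 3) * A n
3*Sn≡[4n+3]*An n = begin-equality
  3 * S n                                            ≡⟨ cong (3 *_) (∑-cong (suc n) (λ k → split k (F n k))) ⟩
  3 * ∑[ k < suc n ] (2 * (k * F n k) + 1 * F n k)   ≡⟨ cong (3 *_) (∑-linear (suc n) 2 1 (λ k → k * F n k) (F n)) ⟩
  3 * (2 * B n + 1 * A n)                            ≡⟨ regroup (B n) (A n) ⟩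
  2 * (3 * B n) + 3 * A n                            ≡⟨ cong (λ u → 2 * u + 3 * A n) (3*Bn≡2n*An n) ⟩
  2 * (2 * n * A n) + 3 * A n                        ≡⟨ collect n (A n) ⟩
  (4 * n + 3) * A n                                  ∎
  where
  split : ∀ k f → f * (2 * k + 1) ≡ 2 * (k * f) + 1 * f
  split = solve-∀
  regroup : ∀ b a → 3 * (2 * b + 1 * a) ≡ 2 * (3 * b) + 3 * a
  regroup = solve-∀
  collect : ∀ n a → 2 * (2 * n * a) + 3 * a ≡ (4 * n + 3) * a
  collect = solve-∀

a₀ a₁ a₂ : ℕ → ℕ
a₂ n = (2 + n) * (2 + n) * ((3 + 4 * n) * (7 + 4 * n))
a₁ n = (10 * (n * n) + 30 * n + 23) * ((3 + 4 * n) * (11 + 4 * n))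
a₀ n = 9 * ((1 + n) * (1 + n)) * ((7 + 4 * n) * (11 + 4 * n))

S-recurrence : ∀ n → a₂ n * S (2 + n) + a₀ n * S n ≡ a₁ n * S (1 + n)
S-recurrence n = *-cancelˡ-≡ _ _ 3 (begin-equality
  3 * (a₂ n * S (2 + n) + a₀ n * S n)
    ≡⟨ spread (a₂ n) (a₀ n) (S (2 + n)) (S n) ⟩
  a₂ n * (3 * S (2 + n)) + a₀ n * (3 * S n)
    ≡⟨ cong₂ (λ u w → a₂ n * u + a₀ n * w) (3*Sn≡[4n+3]*An (2 + n)) (3*Sn≡[4n+3]*An n) ⟩
  a₂ n * ((4 * (2 + n) + 3) * A (2 + n)) + a₀ n * ((4 * n + 3) * A n)
    ≡⟨ factor n (A (2 + n)) (A n) ⟩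
  c * ((2 + n) * (2 + n) * A (2 + n) + 9 * ((1 + n) * (1 + n)) * A n)
    ≡⟨ cong (c *_) (A-recurrence n) ⟩
  c * ((10 * (n * n) + 30 * n + 23) * A (1 + n))
    ≡⟨ refactor n (A (1 + n)) ⟩
  a₁ n * ((4 * (1 + n) + 3) * A (1 + n))
    ≡⟨ cong (a₁ n *_) (3*Sn≡[4n+3]*An (1 + n)) ⟨
  a₁ n * (3 * S (1 + n))
    ≡⟨ x∙yz≈y∙xz (a₁ n) 3 (S (1 + n)) ⟩
  3 * (a₁ n * S (1 + n))
    ∎)
  where
  c = (3 + 4 * n) * (7 + 4 * n) * (11 + 4 * n)
  spread : ∀ d k x y → 3 * (d * x + k * y) ≡ d * (3 * x) + k * (3 * y)
  spread = solve-∀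
  factor : ∀ n x y →
    (2 + n) * (2 + n) * ((3 + 4 * n) * (7 + 4 * n)) * ((4 * (2 + n) + 3) * x)
      + 9 * ((1 + n) * (1 + n)) * ((7 + 4 * n) * (11 + 4 * n)) * ((4 * n + 3) * y)
    ≡ (3 + 4 * n) * (7 + 4 * n) * (11 + 4 * n) * ((2 + n) * (2 + n) * x + 9 * ((1 + n) * (1 + n)) * y)
  factor = solve-∀
  refactor : ∀ n x →
    (3 + 4 * n) * (7 + 4 * n) * (11 + 4 * n) * ((10 * (n * n) + 30 * n + 23) * x)
    ≡ (10 * (n * n) + 30 * n + 23) * ((3 + 4 * n) * (11 + 4 * n)) * ((4 * (1 + n) + 3) * x)
  refactor = solve-∀

m+o≡n⇒m≤n : ∀ {m n} o → m + o ≡ n → m ≤ n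
m+o≡n⇒m≤n {m} o refl = m≤m+n m o

ratio-≤-step : ∀ r {d k p x y z} .{{_ : NonZero r}} .{{_ : NonZero d}} →
               d * z + k * x ≡ p * y → r * p ≤ r * r * d + k → y ≤ r * x → z ≤ r * y
ratio-≤-step r {d} {k} {p} {x} {y} {z} rec slack y≤rx =
  *-cancelˡ-≤ d (*-cancelˡ-≤ r (+-cancelʳ-≤ (k * y) _ _ (begin
    r * (d * z) + k * y          ≤⟨ +-monoʳ-≤ (r * (d * z)) (*-monoʳ-≤ k y≤rx) ⟩
    r * (d * z) + k * (r * x)    ≡⟨ gather r d z k x ⟩
    r * (d * z + k * x)          ≡⟨ cong (r *_) rec ⟩
    r * (p * y)                  ≡⟨ *-assoc r p y ⟨
    r * p * y                    ≤⟨ *-monoˡ-≤ y slack ⟩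
    (r * r * d + k) * y          ≡⟨ spread r d k y ⟩
    r * (d * (r * y)) + k * y    ∎)))
  where
  gather : ∀ r d z k x → r * (d * z) + k * (r * x) ≡ r * (d * z + k * x)
  gather = solve-∀
  spread : ∀ r d k y → (r * r * d + k) * y ≡ r * (d * (r * y)) + k * y
  spread = solve-∀

ratio-≥-step : ∀ {d k p α β α′ β′ x y z} .{{_ : NonZero α}} .{{_ : NonZero d}} →
               d * z + k * x ≡ p * y → k * β * β′ + α * α′ * d ≤ α * β′ * p →
               α * x ≤ β * y → α′ * y ≤ β′ * z
ratio-≥-step {d} {k} {p} {α} {β} {α′} {β′} {x} {y} {z} rec slack αx≤βy =
  *-cancelˡ-≤ α (*-cancelˡ-≤ d (+-cancelʳ-≤ (k * β * β′ * y) _ _ (begin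
    d * (α * (α′ * y)) + k * β * β′ * y        ≡⟨ gather d α α′ y k β β′ ⟩
    (k * β * β′ + α * α′ * d) * y              ≤⟨ *-monoˡ-≤ y slack ⟩
    α * β′ * p * y                             ≡⟨ *-assoc (α * β′) p y ⟩
    α * β′ * (p * y)                           ≡⟨ cong (α * β′ *_) rec ⟨
    α * β′ * (d * z + k * x)                   ≡⟨ spread α β′ d z k x ⟩
    d * (α * (β′ * z)) + k * β′ * (α * x)      ≤⟨ +-monoʳ-≤ (d * (α * (β′ * z))) (*-monoʳ-≤ (k * β′) αx≤βy) ⟩
    d * (α * (β′ * z)) + k * β′ * (β * y)      ≡⟨ cong (d * (α * (β′ * z)) +_) (swap k β′ β y) ⟩
    d * (α * (β′ * z)) + k * β * β′ * y        ∎)))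
  where
  gather : ∀ d α α′ y k β β′ → d * (α * (α′ * y)) + k * β * β′ * y ≡ (k * β * β′ + α * α′ * d) * y
  gather = solve-∀
  spread : ∀ α β′ d z k x → α * β′ * (d * z + k * x) ≡ d * (α * (β′ * z)) + k * β′ * (α * x)
  spread = solve-∀
  swap : ∀ k β′ β y → k * β′ * (β * y) ≡ k * β * β′ * y
  swap = solve-∀

S-ratio-≤ : ∀ n → S (1 + n) ≤ 9 * S n
S-ratio-≤ zero    = ≤ᵇ⇒≤ _ _ tt
S-ratio-≤ (suc n) =
  ratio-≤-step 9 {a₂ n} {a₀ n} {a₁ n} {S n} {S (1 + n)} {S (2 + n)} (S-recurrence n) slack (S-ratio-≤ n)
  where
  identity : ∀ n →
    9 * ((10 * (n * n) + 30 * n + 23) * ((3 + 4 * n) * (11 + 4 * n))) + 9 * (74 + 144 * n + 64 * (n * n))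
    ≡ 9 * 9 * ((2 + n) * (2 + n) * ((3 + 4 * n) * (7 + 4 * n))) + 9 * ((1 + n) * (1 + n)) * ((7 + 4 * n) * (11 + 4 * n))
  identity = solve-∀
  slack : 9 * a₁ n ≤ 9 * 9 * a₂ n + a₀ n
  slack = m+o≡n⇒m≤n (9 * (74 + 144 * n + 64 * (n * n))) (identity n)

-- For n = 3 + t, α t / β t = 9 − 27 / (5 n (n + 3)) bounds S (n + 1) / S n from below; this
-- fails at n = 2. Literals come last in α and slack: a leading literal would make the conversion
-- checker unfold it one suc at a time when comparing α with its expanded form.
α β : ℕ → ℕ
α t = 45 * (t * t) + 405 * t + 783
β t = 5 * ((3 + t) * ((3 + t) + 3))

S-ratio-≥ : ∀ t → α t * S (3 + t) ≤ β t * S (4 + t)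
S-ratio-≥ zero    = ≤ᵇ⇒≤ _ _ tt
S-ratio-≥ (suc t) =
  ratio-≥-step {a₂ (3 + t)} {a₀ (3 + t)} {a₁ (3 + t)} {α t} {β t} {α (1 + t)} {β (1 + t)}
               {S (3 + t)} {S (4 + t)} {S (5 + t)} {{α-nonZero}}
               (S-recurrence (3 + t)) (m+o≡n⇒m≤n (slack t) (identity t)) (S-ratio-≥ t)
  where
  α-nonZero : NonZero (α t)
  α-nonZero = >-nonZero (≤-trans (s≤s z≤n) (m≤n+m 783 (45 * (t * t) + 405 * t)))
  slack : ℕ → ℕ
  slack t = t * (t * (t * (t * (t * (2880 * t + 64080) + 585846) + 2826216) + 7561170) + 10459395) + 5591025
  identity : ∀ t →
    9 * ((1 + (3 + t)) * (1 + (3 + t))) * ((7 + 4 * (3 + t)) * (11 + 4 * (3 + t)))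
      * (5 * ((3 + t) * ((3 + t) + 3))) * (5 * ((3 + (1 + t)) * ((3 + (1 + t)) + 3)))
    + (45 * (t * t) + 405 * t + 783) * (45 * ((1 + t) * (1 + t)) + 405 * (1 + t) + 783)
      * ((2 + (3 + t)) * (2 + (3 + t)) * ((3 + 4 * (3 + t)) * (7 + 4 * (3 + t))))
    + (t * (t * (t * (t * (t * (2880 * t + 64080) + 585846) + 2826216) + 7561170) + 10459395) + 5591025)
    ≡ (45 * (t * t) + 405 * t + 783) * (5 * ((3 + (1 + t)) * ((3 + (1 + t)) + 3)))
      * ((10 * ((3 + t) * (3 + t)) + 30 * (3 + t) + 23) * ((3 + 4 * (3 + t)) * (11 + 4 * (3 + t))))
  identity = solve-∀

S-ratio-deficit : ∀ t → 5 * ((3 + t) * ((3 + t) + 3)) * (9 * S (3 + t) ∸ S (4 + t)) ≤ 27 * S (3 + t)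
S-ratio-deficit t = begin
  β t * (9 * x ∸ y)            ≡⟨ *-distribˡ-∸ (β t) (9 * x) y ⟩
  β t * (9 * x) ∸ β t * y      ≡⟨ cong (_∸ β t * y) (identity t x) ⟩
  α t * x + 27 * x ∸ β t * y   ≤⟨ m≤n+o⇒m∸n≤o (α t * x + 27 * x) (β t * y) (+-monoˡ-≤ (27 * x) (S-ratio-≥ t)) ⟩
  27 * x                       ∎
  where
  x = S (3 + t)
  y = S (4 + t)
  identity : ∀ t x → 5 * ((3 + t) * ((3 + t) + 3)) * (9 * x) ≡ (45 * (t * t) + 405 * t + 783) * x + 27 * x
  identity = solve-∀

^-distribʳ-* : ∀ m n o → (m * n) ^ o ≡ m ^ o * n ^ o
^-distribʳ-* m n zero    = refl
^-distribʳ-* m n (suc o) = trans (cong (m * n *_) (^-distribʳ-* m n o)) (interchange* m n (m ^ o) (n ^ o))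
  where
  interchange* : ∀ a b c d → a * b * (c * d) ≡ a * c * (b * d)
  interchange* = solve-∀

ratio-≤⇒geometric : ∀ {u : ℕ → ℕ} r → (∀ n → u (suc n) ≤ r * u n) → ∀ m t → u (m + t) ≤ r ^ t * u m
ratio-≤⇒geometric {u} r step m zero    = ≤-reflexive (trans (cong u (+-identityʳ m)) (sym (*-identityˡ (u m))))
ratio-≤⇒geometric {u} r step m (suc t) = begin
  u (m + suc t)        ≡⟨ cong u (+-suc m t) ⟩
  u (suc (m + t))      ≤⟨ step (m + t) ⟩
  r * u (m + t)        ≤⟨ *-monoʳ-≤ r (ratio-≤⇒geometric r step m t) ⟩
  r * (r ^ t * u m)    ≡⟨ *-assoc r (r ^ t) (u m) ⟨
  r ^ suc t * u m      ∎

ratio-≤⇒square-bound : ∀ {u : ℕ → ℕ} → (∀ n → u (suc n) ≤ 9 * u n) → ∀ m t →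
                       5 * (u m * u m) < 2 * 81 ^ m → 5 * (u (m + t) * u (m + t)) < 2 * 81 ^ (m + t)
ratio-≤⇒square-bound {u} step m t base = begin-strict
  5 * (u (m + t) * u (m + t))          ≤⟨ *-monoʳ-≤ 5 (*-mono-≤ geometric geometric) ⟩
  5 * (9 ^ t * u m * (9 ^ t * u m))    ≡⟨ regroup (9 ^ t) (u m) ⟩
  5 * (u m * u m) * (9 ^ t * 9 ^ t)    ≡⟨ cong (5 * (u m * u m) *_) (^-distribʳ-* 9 9 t) ⟨
  5 * (u m * u m) * 81 ^ t             <⟨ *-monoˡ-< (81 ^ t) {{m^n≢0 81 t}} base ⟩
  2 * 81 ^ m * 81 ^ t                  ≡⟨ *-assoc 2 (81 ^ m) (81 ^ t) ⟩
  2 * (81 ^ m * 81 ^ t)                ≡⟨ cong (2 *_) (^-distribˡ-+-* 81 m t) ⟨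
  2 * 81 ^ (m + t)                     ∎
  where
  geometric = ratio-≤⇒geometric {u} 9 step m t
  regroup : ∀ a s → 5 * (a * s * (a * s)) ≡ 5 * (s * s) * (a * a)
  regroup = solve-∀

[b+d]^[1+N]≤[b+d]*b^N+N*d*[b+d]^N : ∀ N b d → (b + d) ^ suc N ≤ (b + d) * b ^ N + N * d * (b + d) ^ N
[b+d]^[1+N]≤[b+d]*b^N+N*d*[b+d]^N zero    b d = ≤-reflexive (sym (+-identityʳ _))
[b+d]^[1+N]≤[b+d]*b^N+N*d*[b+d]^N (suc N) b d = begin
  (b + d) * (b + d) ^ suc N
    ≤⟨ *-monoʳ-≤ (b + d) ([b+d]^[1+N]≤[b+d]*b^N+N*d*[b+d]^N N b d) ⟩
  (b + d) * ((b + d) * b ^ N + N * d * (b + d) ^ N)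
    ≡⟨ expand b d (b ^ N) ((b + d) ^ N) N ⟩
  (b + d) * (b * b ^ N) + N * d * ((b + d) * (b + d) ^ N) + d * ((b + d) * b ^ N)
    ≤⟨ +-monoʳ-≤ _ (*-monoʳ-≤ d (*-monoʳ-≤ (b + d) (^-monoˡ-≤ N (m≤m+n b d)))) ⟩
  (b + d) * (b * b ^ N) + N * d * ((b + d) * (b + d) ^ N) + d * ((b + d) * (b + d) ^ N)
    ≡⟨ collect b d (b ^ N) ((b + d) ^ N) N ⟩
  (b + d) * (b * b ^ N) + suc N * d * ((b + d) * (b + d) ^ N) ∎
  where
  expand : ∀ b d p q N → (b + d) * ((b + d) * p + N * d * q) ≡ (b + d) * (b * p) + N * d * ((b + d) * q) + d * ((b + d) * p)
  expand = solve-∀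
  collect : ∀ b d p q N → (b + d) * (b * p) + N * d * ((b + d) * q) + d * ((b + d) * q)
                          ≡ (b + d) * (b * p) + (1 + N) * d * ((b + d) * q)
  collect = solve-∀

pow-ratio-bound : ∀ N {a b} .{{_ : NonZero a}} → b ≤ a → 5 * N * (a ∸ b) ≤ 3 * a → 2 * a ^ N ≤ 5 * b ^ N
pow-ratio-bound N {a} {b} b≤a deficit = *-cancelˡ-≤ a (+-cancelʳ-≤ (3 * (a * a ^ N)) _ _ (begin
  a * (2 * a ^ N) + 3 * (a * a ^ N)                 ≡⟨ gather a (a ^ N) ⟩
  5 * a ^ suc N                                     ≡⟨ cong (λ c → 5 * c ^ suc N) b+d≡a ⟨
  5 * (b + d) ^ suc N                               ≤⟨ *-monoʳ-≤ 5 ([b+d]^[1+N]≤[b+d]*b^N+N*d*[b+d]^N N b d) ⟩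
  5 * ((b + d) * b ^ N + N * d * (b + d) ^ N)       ≡⟨ cong (λ c → 5 * (c * b ^ N + N * d * c ^ N)) b+d≡a ⟩
  5 * (a * b ^ N + N * d * a ^ N)                   ≡⟨ spread a (b ^ N) N d (a ^ N) ⟩
  a * (5 * b ^ N) + 5 * N * d * a ^ N               ≤⟨ +-monoʳ-≤ (a * (5 * b ^ N)) (*-monoˡ-≤ (a ^ N) deficit) ⟩
  a * (5 * b ^ N) + 3 * a * a ^ N                   ≡⟨ cong (a * (5 * b ^ N) +_) (*-assoc 3 a (a ^ N)) ⟩
  a * (5 * b ^ N) + 3 * (a * a ^ N)                 ∎))
  where
  d = a ∸ b
  b+d≡a = m+[n∸m]≡n b≤a
  gather : ∀ a p → a * (2 * p) + 3 * (a * p) ≡ 5 * (a * p)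
  gather = solve-∀
  spread : ∀ a q N d p → 5 * (a * q + N * d * p) ≡ a * (5 * q) + 5 * N * d * p
  spread = solve-∀

root-ratio-reduced : ∀ n {x y} .{{_ : NonZero y}} →
                     2 * (9 * x) ^ (n * (n + 3)) ≤ 5 * y ^ (n * (n + 3)) → 5 * (x * x) < 2 * 81 ^ n →
                     9 ^ (n * (n + 1)) * (x * (x * x ^ (n * (n + 3)))) < y ^ (n * (n + 3))
root-ratio-reduced n {x} {y} power small = *-cancelˡ-< (10 * 81 ^ n) _ _ (begin-strict
  10 * 81 ^ n * (9 ^ e * (x * (x * x ^ N)))    ≡⟨ regroup (81 ^ n) (9 ^ e) x (x ^ N) ⟩
  2 * (9 ^ e * 81 ^ n * x ^ N) * (5 * (x * x))  ≡⟨ cong (λ c → 2 * (c * x ^ N) * (5 * (x * x))) 9^N≡9^e*81^n ⟨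
  2 * (9 ^ N * x ^ N) * (5 * (x * x))           ≡⟨ cong (λ c → 2 * c * (5 * (x * x))) (^-distribʳ-* 9 x N) ⟨
  2 * (9 * x) ^ N * (5 * (x * x))               ≤⟨ *-monoˡ-≤ (5 * (x * x)) power ⟩
  5 * y ^ N * (5 * (x * x))                     <⟨ *-monoʳ-< (5 * y ^ N) {{m*n≢0 5 (y ^ N) {{_}} {{m^n≢0 y N}}}} small ⟩
  5 * y ^ N * (2 * 81 ^ n)                      ≡⟨ swap (y ^ N) (81 ^ n) ⟩
  10 * 81 ^ n * y ^ N                           ∎)
  where
  e = n * (n + 1)
  N = n * (n + 3)
  9^N≡9^e*81^n : 9 ^ N ≡ 9 ^ e * 81 ^ n
  9^N≡9^e*81^n = begin-equality
    9 ^ N              ≡⟨ cong (9 ^_) (exponent n) ⟩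
    9 ^ (e + 2 * n)    ≡⟨ ^-distribˡ-+-* 9 e (2 * n) ⟩
    9 ^ e * 9 ^ (2 * n) ≡⟨ cong (9 ^ e *_) (^-*-assoc 9 2 n) ⟨
    9 ^ e * 81 ^ n     ∎
    where
    exponent : ∀ n → n * (n + 3) ≡ n * (n + 1) + 2 * n
    exponent = solve-∀
  regroup : ∀ a b x p → 10 * a * (b * (x * (x * p))) ≡ 2 * (b * a * p) * (5 * (x * x))
  regroup = solve-∀
  swap : ∀ q a → 5 * q * (2 * a) ≡ 10 * a * q
  swap = solve-∀

root-ratio-criterion : ∀ n {x y z} .{{_ : NonZero x}} .{{_ : NonZero y}} →
                       z ≤ 9 * y → y ≤ 9 * x → 5 * (n * (n + 3)) * (9 * x ∸ y) ≤ 27 * x →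
                       5 * (x * x) < 2 * 81 ^ n →
                       z ^ (n * (n + 1)) * x ^ ((n + 1) * (n + 2)) < y ^ (2 * n * (n + 2))
root-ratio-criterion n {x} {y} {z} z≤9y y≤9x deficit small = begin-strict
  z ^ e * x ^ ((n + 1) * (n + 2))       ≡⟨ cong (λ m → z ^ e * x ^ m) (exponent₁ n) ⟩
  z ^ e * (x * (x * x ^ N))             ≤⟨ *-monoˡ-≤ (x * (x * x ^ N)) (^-monoˡ-≤ e z≤9y) ⟩
  (9 * y) ^ e * (x * (x * x ^ N))       ≡⟨ cong (_* (x * (x * x ^ N))) (^-distribʳ-* 9 y e) ⟩
  9 ^ e * y ^ e * (x * (x * x ^ N))     ≡⟨ xy∙z≈y∙xz (9 ^ e) (y ^ e) (x * (x * x ^ N)) ⟩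
  y ^ e * (9 ^ e * (x * (x * x ^ N)))   <⟨ *-monoʳ-< (y ^ e) {{m^n≢0 y e}} (root-ratio-reduced n {x} {y} power small) ⟩
  y ^ e * y ^ N                         ≡⟨ ^-distribˡ-+-* y e N ⟨
  y ^ (e + N)                           ≡⟨ cong (y ^_) (exponent₂ n) ⟩
  y ^ (2 * n * (n + 2))                 ∎
  where
  e = n * (n + 1)
  N = n * (n + 3)
  power : 2 * (9 * x) ^ N ≤ 5 * y ^ N
  power = pow-ratio-bound N {{m*n≢0 9 x}} y≤9x (≤-trans deficit (≤-reflexive (*-assoc 3 9 x)))
  exponent₁ : ∀ n → (n + 1) * (n + 2) ≡ 2 + n * (n + 3)
  exponent₁ = solve-∀
  exponent₂ : ∀ n → n * (n + 1) + n * (n + 3) ≡ 2 * n * (n + 2)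
  exponent₂ = solve-∀

corollary4p10 : ∀ (n : ℕ) → 1 ≤ n →
    S (n + 2) ^ (n * (n + 1)) * S n ^ ((n + 1) * (n + 2)) < S (n + 1) ^ (2 * n * (n + 2))
corollary4p10 1 _ = ≤ᵇ⇒≤ _ _ tt
corollary4p10 2 _ = ≤ᵇ⇒≤ _ _ tt
corollary4p10 3 _ = ≤ᵇ⇒≤ _ _ tt
corollary4p10 n@(suc (suc (suc (suc t)))) _ =
  subst₂ (λ y z → z ^ (n * (n + 1)) * S n ^ ((n + 1) * (n + 2)) < y ^ (2 * n * (n + 2)))
         (cong S (+-comm 1 n)) (cong S (+-comm 2 n))
         (root-ratio-criterion n {S n} {S (1 + n)} {S (2 + n)}
            (S-ratio-≤ (1 + n)) (S-ratio-≤ n) (S-ratio-deficit (1 + t))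
            (ratio-≤⇒square-bound {S} S-ratio-≤ 4 t (≤ᵇ⇒≤ _ _ tt)))
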